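{- Let $q\ge1$, $n\ge1$ and let $(G,H_i)_{i=1}^{q+2}$ be a group packet in $(q+2)\text{ -GP}(n)$ with common pairwise intersection $K$. Then $S=G/K$, $X_i=G/H_i$, $\pi_i\colon G/K\to G/H_i$, $gK\mapsto gH_i$, defines a transitive orthogonal array in $(q+2)\text{ -OA}(n)$; i.e. the map $gK\mapsto (gH_i)_{i=1}^{q+2}$ embeds $G/K$ into $\prod_{i=1}^{q+2}G/H_i$ and the resulting array is a transitive element of $(q+2)\text{ -OA}(n)$.
   Context: A group packet in $(q+2)\text{ -GP}(n)$ is the data $(G,H_i)_{i=1}^{q+2}$ of a group $G$ and subgroups $H_i\le G$ such that there is a subgroup $K$ with $H_i\cap H_j=K$ for all $i\neq j$ and $[G:H_i]=[H_i:K]=n$ for all $i$. An element of $(q+2)\text{ -OA}(n)$ is the data $(S,X_i,\pi_i)_{i=1}^{q+2}$ of a set $S$, sets $X_i$ with $|X_i|=n$, and maps $\pi_i\colon S\to X_i$ such that for all $i\ne j$ the map $\pi_i\times\pi_j\colon S\to X_i\times X_j$ is a bijection. Regarding $S\subset\prod_i X_i$ via $\prod_i\pi_i$, the autotopy group is $\mathrm{Aut}(S,X_i)=\{(\sigma_i)\in\prod_i\mathrm{Sym}(X_i):(\sigma_i)(S)=S\}$, acting on $S$ and on each $X_i$; the array is transitive if this group acts transitively on $S$. -}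

module Defs where

open import Level using (Level; _⊔_; suc)
open import Data.Nat using (ℕ)
open import Data.Fin using (Fin; zero) renaming (suc to fsuc)
open import Data.Product using (Σ; ∃; _×_; _,_; proj₁; proj₂)
open import Relation.Nullary using (¬_)
open import Relation.Binary using (Setoid; Rel; IsEquivalence)
import Relation.Binary.Construct.On as On
open import Relation.Binary.PropositionalEquality as ≡ using (_≡_; _≢_)
open import Function.Bundles using (Func; Inverse)
open import Function.Definitions using (Injective; Bijective)
open import Data.Product.Relation.Binary.Pointwise.NonDependent using (Pointwise)
open import Algebra.Bundles using (Group)
import Algebra.Properties.Group as GP
import Relation.Binary.Reasoning.Setoid as SetoidR

HasSize : ∀ {a ℓ} → ℕ → Setoid a ℓ → Set (a ⊔ ℓ)
HasSize n A = Inverse (≡.setoid (Fin n)) A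

record Subgroup {c ℓ} (G : Group c ℓ) (p : Level) : Set (c ⊔ ℓ ⊔ suc p) where
  open Group G
  field
    mem   : Carrier → Set p
    resp  : ∀ {x y} → x ≈ y → mem x → mem y
    ε∈    : mem ε
    ∙∈    : ∀ {x y} → mem x → mem y → mem (x ∙ y)
    ⁻¹∈   : ∀ {x} → mem x → mem (x ⁻¹)

module _ {c ℓ} (G : Group c ℓ) where
  open Group G
  open GP G

  -- x H = y H  iff  x⁻¹ y ∈ H
  _∼[_]_ : ∀ {p} → Carrier → Subgroup G p → Carrier → Set p
  x ∼[ H ] y = Subgroup.mem H (x ⁻¹ ∙ y)

  cosetEquiv : ∀ {p} (H : Subgroup G p) → IsEquivalence (λ x y → x ∼[ H ] y)
  cosetEquiv H = record
    { refl  = λ {x} → resp (sym (inverseˡ x)) ε∈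
    ; sym   = λ {x} {y} h → resp (symm x y) (⁻¹∈ h)
    ; trans = λ {x} {y} {z} h k → resp (tr x y z) (∙∈ h k)
    }
    where
    open Subgroup H
    open SetoidR setoid
    symm : ∀ x y → (x ⁻¹ ∙ y) ⁻¹ ≈ y ⁻¹ ∙ x
    symm x y = begin
      (x ⁻¹ ∙ y) ⁻¹        ≈⟨ ⁻¹-anti-homo-∙ (x ⁻¹) y ⟩
      y ⁻¹ ∙ (x ⁻¹) ⁻¹     ≈⟨ ∙-congˡ (⁻¹-involutive x) ⟩
      y ⁻¹ ∙ x             ∎
    tr : ∀ x y z → (x ⁻¹ ∙ y) ∙ (y ⁻¹ ∙ z) ≈ x ⁻¹ ∙ z
    tr x y z = begin
      (x ⁻¹ ∙ y) ∙ (y ⁻¹ ∙ z)   ≈⟨ assoc (x ⁻¹) y (y ⁻¹ ∙ z) ⟩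
      x ⁻¹ ∙ (y ∙ (y ⁻¹ ∙ z))   ≈⟨ ∙-congˡ (sym (assoc y (y ⁻¹) z)) ⟩
      x ⁻¹ ∙ ((y ∙ y ⁻¹) ∙ z)   ≈⟨ ∙-congˡ (∙-congʳ (inverseʳ y)) ⟩
      x ⁻¹ ∙ (ε ∙ z)            ≈⟨ ∙-congˡ (identityˡ z) ⟩
      x ⁻¹ ∙ z                  ∎

  cosets : ∀ {p} → Subgroup G p → Setoid c p
  cosets H = record { Carrier = Carrier ; _≈_ = λ x y → x ∼[ H ] y ; isEquivalence = cosetEquiv H }

  -- The left coset space H / K (cosets of K inside H), as a setoid
  cosetsIn : ∀ {p r} → Subgroup G p → Subgroup G r → Setoid (c ⊔ p) r
  cosetsIn H K = record
    { Carrier = Σ Carrier (Subgroup.mem H)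
    ; _≈_ = λ x y → proj₁ x ∼[ K ] proj₁ y
    ; isEquivalence = On.isEquivalence proj₁ (cosetEquiv K) }

  Index_≡_ : ∀ {p} → Subgroup G p → ℕ → Set (c ⊔ p)
  Index H ≡ n = HasSize n (cosets H)

  RelIndex : ∀ {p r} → Subgroup G p → Subgroup G r → ℕ → Set (c ⊔ p ⊔ r)
  RelIndex H K n = HasSize n (cosetsIn H K)

record IsGroupPacket {c ℓ p r} (m n : ℕ) (G : Group c ℓ)
    (H : Fin m → Subgroup G p) (K : Subgroup G r) : Set (c ⊔ p ⊔ r) where
  field
    intersect : ∀ i j → i ≢ j → ∀ x →
      ((Subgroup.mem (H i) x × Subgroup.mem (H j) x) → Subgroup.mem K x)
      × (Subgroup.mem K x → (Subgroup.mem (H i) x × Subgroup.mem (H j) x))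
    index    : ∀ i → Index_≡_ G (H i) n
    relIndex : ∀ i → RelIndex G (H i) K n

-- With at least two subgroups, K ⊆ H_i for every i (derived, needed to
-- define the projections gK ↦ gH_i).
packet-K⊆H : ∀ {c ℓ p r} {q n : ℕ} {G : Group c ℓ}
  {H : Fin (ℕ.suc (ℕ.suc q)) → Subgroup G p} {K : Subgroup G r} →
  IsGroupPacket (ℕ.suc (ℕ.suc q)) n G H K →
  ∀ i {x} → Subgroup.mem K x → Subgroup.mem (H i) x
packet-K⊆H P zero    k = proj₁ (proj₂ (IsGroupPacket.intersect P zero (fsuc zero) (λ ()) _) k)
packet-K⊆H P (fsuc i) k = proj₁ (proj₂ (IsGroupPacket.intersect P (fsuc i) zero (λ ()) _) k)

cosetProj : ∀ {c ℓ p r} {q n : ℕ} {G : Group c ℓ}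
  {H : Fin (ℕ.suc (ℕ.suc q)) → Subgroup G p} {K : Subgroup G r} →
  IsGroupPacket (ℕ.suc (ℕ.suc q)) n G H K →
  ∀ i → Func (cosets G K) (cosets G (H i))
cosetProj P i = record { to = λ g → g ; cong = packet-K⊆H P i }

module _ {s ℓs x ℓx} {m : ℕ} (S : Setoid s ℓs) (X : Fin m → Setoid x ℓx)
         (π : ∀ i → Func S (X i)) where
  private
    _≈S_ = Setoid._≈_ S
    Tuple = (i : Fin m) → Setoid.Carrier (X i)
    _≈T_ : Rel Tuple ℓx
    u ≈T v = ∀ i → Setoid._≈_ (X i) (u i) (v i)

  prodMap : Setoid.Carrier S → Tuple
  prodMap a i = Func.to (π i) a

  pairMap : ∀ i j → Setoid.Carrier S → Setoid.Carrier (X i) × Setoid.Carrier (X j)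
  pairMap i j a = Func.to (π i) a , Func.to (π j) a

  record IsOA (n : ℕ) : Set (s ⊔ ℓs ⊔ x ⊔ ℓx) where
    field
      size : ∀ i → HasSize n (X i)
      pairBij : ∀ i j → i ≢ j →
        Bijective _≈S_ (Pointwise (Setoid._≈_ (X i)) (Setoid._≈_ (X j))) (pairMap i j)

  Embeds : Set (s ⊔ ℓs ⊔ ℓx)
  Embeds = Injective _≈S_ _≈T_ prodMap

  InS : Tuple → Set (s ⊔ ℓx)
  InS u = ∃ λ a → prodMap a ≈T u

  record Autotopy : Set (s ⊔ x ⊔ ℓx) where
    field
      σ : ∀ i → Inverse (X i) (X i)
    act : Tuple → Tuple
    act u i = Inverse.to (σ i) (u i)
    field
      maps-into : ∀ u → InS u → InS (act u)
      maps-onto : ∀ v → InS v → ∃ λ u → InS u × (act u ≈T v)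

  Transitive : Set (s ⊔ x ⊔ ℓx)
  Transitive = ∀ a b → ∃ λ (τ : Autotopy) → Autotopy.act τ (prodMap a) ≈T prodMap b

{-# OPTIONS --safe #-}
-- Left multiplication by g permutes every coset space G/H_i and maps the image
-- of G/K onto itself, so the autotopy group is transitive on G/K. For i ≢ j the
-- map gK ↦ (gH_i , gH_j) is injective because H_i ∩ H_j = K. Composing it with
-- the n² pairwise K-incongruent products r h of a representative r of G/H_i and a
-- representative h of H_i/K gives an injection between two sets of size n², which
-- must be onto; hence gK ↦ (gH_i , gH_j) is a bijection.
module Submission where

open import Defs
open import Data.Nat using (ℕ; suc; _≥_; _*_)
open import Data.Nat.Properties using (1+n≰n)
open import Data.Fin using (Fin; zero; punchOut) renaming (suc to fsuc)
open import Data.Fin.Properties using (any?; _≟_; punchOut-injective; injective⇒≤; *↔×)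
open import Data.Product using (_×_; _,_; proj₁; proj₂)
open import Data.Product.Relation.Binary.Pointwise.NonDependent using (_×ₛ_; Pointwise-≡↔≡)
open import Data.Product.Function.NonDependent.Setoid using (_×-inverse_; <_,_>ₛ)
open import Relation.Nullary using (yes; no)
open import Relation.Nullary.Negation using (contradiction)
open import Relation.Binary using (Setoid)
open import Relation.Binary.PropositionalEquality as ≡ using (_≡_; _≢_; refl)
open import Function.Base using (_∘_)
open import Function.Bundles using (Func; Inverse; Injection)
open import Function.Definitions using (Injective; StrictlySurjective; Bijective)
open import Function.Consequences using (strictlySurjective⇒surjective)
open import Function.Properties.Inverse using (Inverse⇒Injection)
import Function.Construct.Composition as Composition
import Function.Construct.Symmetry as Symmetry
open import Algebra.Bundles using (Group)
import Algebra.Properties.Group as GroupProperties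
import Relation.Binary.Reasoning.Setoid as SetoidReasoning

Fin-injective⇒surjective : ∀ {m} {f : Fin m → Fin m} →
  Injective _≡_ _≡_ f → StrictlySurjective _≡_ f
Fin-injective⇒surjective {suc m} {f} f-injective y with any? (λ x → f x ≟ y)
... | yes hit  = hit
... | no  miss = contradiction (injective⇒≤ f̂-injective) 1+n≰n
  where
  f̂ : Fin (suc m) → Fin m
  f̂ x = punchOut {i = y} {j = f x} (λ y≡fx → miss (x , ≡.sym y≡fx))

  f̂-injective : Injective _≡_ _≡_ f̂
  f̂-injective f̂x≡f̂y = f-injective (punchOut-injective {i = y} _ _ f̂x≡f̂y)

module _ {a b ℓa ℓb} {A : Setoid a ℓa} {B : Setoid b ℓb} where
  private
    module A = Setoid A
    module B = Setoid B

  HasSize-×ₛ : ∀ {m k} → HasSize m A → HasSize k B → HasSize (m * k) (A ×ₛ B)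
  HasSize-×ₛ A-size B-size =
    Composition.inverse (Composition.inverse *↔× (Symmetry.inverse Pointwise-≡↔≡))
                        (A-size ×-inverse B-size)

  injective⇒surjective : ∀ {m} → HasSize m A → HasSize m B →
    {f : A.Carrier → B.Carrier} → Injective A._≈_ B._≈_ f → StrictlySurjective B._≈_ f
  injective⇒surjective {m} A-size B-size {f} f-injective y =
    let x , f̂x≡y = Fin-injective⇒surjective f̂-injective (from-B y)
    in  to-A x , from-B-injective f̂x≡y
    where
    to-A : Fin m → A.Carrier
    to-A = Inverse.to A-size

    from-B : B.Carrier → Fin m
    from-B = Inverse.from B-size

    to-A-injective : Injective _≡_ A._≈_ to-A
    to-A-injective = Injection.injective (Inverse⇒Injection A-size)

    from-B-injective : Injective B._≈_ _≡_ from-B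
    from-B-injective = Injection.injective (Inverse⇒Injection (Symmetry.inverse B-size))

    f̂ : Fin m → Fin m
    f̂ = from-B ∘ f ∘ to-A

    f̂-injective : Injective _≡_ _≡_ f̂
    f̂-injective f̂x≡f̂y = to-A-injective (f-injective (from-B-injective f̂x≡f̂y))

module Cosets {c ℓ} (G : Group c ℓ) where
  open Group G
  open GroupProperties G using (⁻¹-anti-homo-∙; \\-leftDividesˡ; \\-leftDividesʳ)

  infix 4 _∼_mod_
  _∼_mod_ : ∀ {p} → Carrier → Carrier → Subgroup G p → Set p
  x ∼ y mod L = _∼[_]_ G x L y

  [g∙x]⁻¹∙[g∙y]≈x⁻¹∙y : ∀ g x y → (g ∙ x) ⁻¹ ∙ (g ∙ y) ≈ x ⁻¹ ∙ y
  [g∙x]⁻¹∙[g∙y]≈x⁻¹∙y g x y = begin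
    (g ∙ x) ⁻¹ ∙ (g ∙ y)     ≈⟨ ∙-congʳ (⁻¹-anti-homo-∙ g x) ⟩
    x ⁻¹ ∙ g ⁻¹ ∙ (g ∙ y)    ≈⟨ assoc (x ⁻¹) (g ⁻¹) (g ∙ y) ⟩
    x ⁻¹ ∙ (g ⁻¹ ∙ (g ∙ y))  ≈⟨ ∙-congˡ (\\-leftDividesʳ g y) ⟩
    x ⁻¹ ∙ y                 ∎
    where open SetoidReasoning setoid

  module _ {p} (L : Subgroup G p) where
    open Subgroup L
    open Setoid (cosets G L) using () renaming (trans to ∼-trans)

    ≈⇒∼ : ∀ {x y} → x ≈ y → x ∼ y mod L
    ≈⇒∼ {x} x≈y = resp (trans (sym (inverseˡ x)) (∙-congˡ x≈y)) ε∈

    ∼-∙ˡ : ∀ g {x y} → x ∼ y mod L → g ∙ x ∼ g ∙ y mod L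
    ∼-∙ˡ g {x} {y} = resp (sym ([g∙x]⁻¹∙[g∙y]≈x⁻¹∙y g x y))

    leftMul : Carrier → Inverse (cosets G L) (cosets G L)
    leftMul g = record
      { to        = g ∙_
      ; from      = g ⁻¹ ∙_
      ; to-cong   = ∼-∙ˡ g
      ; from-cong = ∼-∙ˡ (g ⁻¹)
      ; inverse   = (λ {x} y∼g⁻¹x → ∼-trans (∼-∙ˡ g y∼g⁻¹x) (≈⇒∼ (\\-leftDividesˡ g x)))
                  , (λ {x} y∼gx → ∼-trans (∼-∙ˡ (g ⁻¹) y∼gx) (≈⇒∼ (\\-leftDividesʳ g x)))
      }

  module _ {p r m k} {H : Subgroup G p} {K : Subgroup G r}
           (index : Index_≡_ G H m) (relIndex : RelIndex G H K k) where
    private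
      module I = Inverse index
      module R = Inverse relIndex

    productOfRepresentatives : Fin m × Fin k → Carrier
    productOfRepresentatives (a , b) = I.to a ∙ proj₁ (R.to b)

    productOfRepresentatives-injective : (∀ {x} → Subgroup.mem K x → Subgroup.mem H x) →
      Injective _≡_ (λ x y → x ∼ y mod K) productOfRepresentatives
    productOfRepresentatives-injective K⊆H {a , b} {a′ , b′} rh∼r′h′ =
      ≡.cong₂ _,_ a≡a′ (b≡b′ a≡a′)
      where
      open SetoidReasoning (cosets G H)

      r∼rh : ∀ a b → I.to a ∼ productOfRepresentatives (a , b) mod H
      r∼rh a b = Subgroup.resp H (sym (\\-leftDividesʳ (I.to a) _)) (proj₂ (R.to b))

      a≡a′ : a ≡ a′
      a≡a′ = Injection.injective (Inverse⇒Injection index) (begin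
        I.to a                             ≈⟨ r∼rh a b ⟩
        productOfRepresentatives (a , b)   ≈⟨ K⊆H rh∼r′h′ ⟩
        productOfRepresentatives (a′ , b′) ≈⟨ r∼rh a′ b′ ⟨
        I.to a′                            ∎)

      b≡b′ : a ≡ a′ → b ≡ b′
      b≡b′ refl = Injection.injective (Inverse⇒Injection relIndex)
        (Subgroup.resp K ([g∙x]⁻¹∙[g∙y]≈x⁻¹∙y (I.to a) _ _) rh∼r′h′)

module GroupPacket {c ℓ p r q n} {G : Group c ℓ}
    {H : Fin (suc (suc q)) → Subgroup G p} {K : Subgroup G r}
    (P : IsGroupPacket (suc (suc q)) n G H K) where
  open Group G using (Carrier; _∙_; _⁻¹)
  open GroupProperties G using (\\-leftDividesˡ; //-rightDividesˡ)
  open Cosets G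
  open IsGroupPacket P

  private
    S = cosets G K
    X = λ i → cosets G (H i)
    π = cosetProj P

  ∼-meet : ∀ {i j x y} → i ≢ j → x ∼ y mod H i → x ∼ y mod H j → x ∼ y mod K
  ∼-meet {i} {j} {x} {y} i≢j x∼y x∼′y = proj₁ (intersect i j i≢j (x ⁻¹ ∙ y)) (x∼y , x∼′y)

  module _ {i j : Fin (suc (suc q))} (i≢j : i ≢ j) where
    private
      Xᵢ×Xⱼ = X i ×ₛ X j

    pairMap-injective : Injective (Setoid._≈_ S) (Setoid._≈_ Xᵢ×Xⱼ) (pairMap S X π i j)
    pairMap-injective (x∼y , x∼′y) = ∼-meet i≢j x∼y x∼′y

    pairMap-strictlySurjective : StrictlySurjective (Setoid._≈_ Xᵢ×Xⱼ) (pairMap S X π i j)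
    pairMap-strictlySurjective xy =
      let u , π[rh]≈xy = injective⇒surjective *↔× (HasSize-×ₛ (index i) (index j))
                           {pairMap S X π i j ∘ rh} (rh-injective ∘ pairMap-injective) xy
      in  rh u , π[rh]≈xy
      where
      rh : Fin n × Fin n → Carrier
      rh = productOfRepresentatives {H = H i} {K = K} (index i) (relIndex i)

      rh-injective : Injective _≡_ (λ x y → x ∼ y mod K) rh
      rh-injective = productOfRepresentatives-injective {H = H i} {K = K}
                       (index i) (relIndex i) (packet-K⊆H P i)

    pairMap-bijective : Bijective (Setoid._≈_ S) (Setoid._≈_ Xᵢ×Xⱼ) (pairMap S X π i j)
    pairMap-bijective =
      pairMap-injective ,
      strictlySurjective⇒surjective {≈₂ = Setoid._≈_ Xᵢ×Xⱼ}
        (Setoid.trans Xᵢ×Xⱼ) (Func.cong < π i , π j >ₛ)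
        pairMap-strictlySurjective

  embeds : Embeds S X π
  embeds πx≈πy = ∼-meet {zero} {fsuc zero} (λ ()) (πx≈πy zero) (πx≈πy (fsuc zero))

  isOA : IsOA S X π n
  isOA = record { size = index ; pairBij = λ i j → pairMap-bijective }

  leftMulAutotopy : Carrier → Autotopy S X π
  leftMulAutotopy g = record
    { σ         = λ i → leftMul (H i) g
    ; maps-into = λ { u (x , πx≈u) → g ∙ x , λ i → ∼-∙ˡ (H i) g (πx≈u i) }
    ; maps-onto = λ { v (x , πx≈v) → (λ i → g ⁻¹ ∙ v i)
                    , (g ⁻¹ ∙ x , λ i → ∼-∙ˡ (H i) (g ⁻¹) (πx≈v i))
                    , λ i → ≈⇒∼ (H i) (\\-leftDividesˡ g (v i)) }
    }

  transitive : Transitive S X π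
  transitive a b = leftMulAutotopy (b ∙ a ⁻¹) , λ i → ≈⇒∼ (H i) (//-rightDividesˡ a b)

lemma3p10 : ∀ {c ℓ p r} (q n : ℕ) → q ≥ 1 → n ≥ 1 →
    (G : Group c ℓ) (H : Fin (suc (suc q)) → Subgroup G p) (K : Subgroup G r) →
    (P : IsGroupPacket (suc (suc q)) n G H K) →
    Embeds (cosets G K) (λ i → cosets G (H i)) (cosetProj P)
      × IsOA (cosets G K) (λ i → cosets G (H i)) (cosetProj P) n
      × Transitive (cosets G K) (λ i → cosets G (H i)) (cosetProj P)
lemma3p10 q n _ _ G H K P = embeds , isOA , transitive
  where open GroupPacket P
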